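{- Let $\pi$ be a permutation of length $n-1$ avoiding the patterns $3142$ and $2\underline{41}3$ and having exactly $m$ occurrences of the mesh pattern $M$. Then inserting the letter $n$ immediately before the last left-to-right maximum of $\pi$ produces a permutation with exactly $m+1$ occurrences of $M$, and inserting $n$ immediately before any other left-to-right maximum of $\pi$ produces a permutation with exactly $m$ occurrences of $M$.
   Context: For a permutation $\pi=\pi_1\cdots\pi_n$: it contains $3142$ if there are $i<j<k<l$ with $\pi_j<\pi_l<\pi_i<\pi_k$; it contains the vincular pattern $2\underline{41}3$ if there are $i<j$ and $k>j+1$ with $\pi_{j+1}<\pi_i<\pi_k<\pi_j$. An occurrence of the mesh pattern $M$ is an index $i$ with $\pi_i>\pi_{i+1}$ such that every $\pi_j$ with $j>i+1$ satisfies $\pi_j>\pi_i$ or $\pi_j<\pi_{i+1}$; the number of occurrences of $M$ is the number of such indices. $\pi_i$ is a left-to-right maximum if $\pi_i>\pi_j$ for all $j<i$. -}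

module Defs where

open import Data.Nat using (ℕ; zero; suc; _<_; _>_; _≤_; _<?_)
open import Data.Nat.Properties using (_≟_)
open import Data.Fin using (Fin; toℕ)
open import Data.Fin.Properties using (all?; any?)
open import Data.List using (List; length; lookup; filter; allFin; take; drop; _++_; _∷_; applyUpTo)
open import Data.List.Relation.Binary.Permutation.Propositional using (_↭_)
open import Data.Product using (Σ; ∃; _×_; _,_)
open import Data.Sum using (_⊎_)
open import Relation.Nullary using (¬_; Dec)
open import Relation.Nullary.Decidable using (_×-dec_; _⊎-dec_; _→-dec_)
open import Relation.Binary.PropositionalEquality using (_≡_)

-- π is a permutation of {1,…,k} (one-line notation as a list)
IsPerm : ℕ → List ℕ → Set
IsPerm k π = π ↭ applyUpTo suc k

_!_ : (π : List ℕ) → Fin (length π) → ℕ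
π ! i = lookup π i

Contains3142 : List ℕ → Set
Contains3142 π = Σ (Fin (length π)) λ i → Σ (Fin (length π)) λ j →
  Σ (Fin (length π)) λ k → Σ (Fin (length π)) λ l →
  toℕ i < toℕ j × toℕ j < toℕ k × toℕ k < toℕ l ×
  (π ! j) < (π ! l) × (π ! l) < (π ! i) × (π ! i) < (π ! k)

-- contains the vincular pattern 2-41-3: i<j, j1 = j+1, k > j+1,
-- π_{j+1} < π_i < π_k < π_j
Contains2413v : List ℕ → Set
Contains2413v π = Σ (Fin (length π)) λ i → Σ (Fin (length π)) λ j →
  Σ (Fin (length π)) λ j1 → Σ (Fin (length π)) λ k →
  toℕ i < toℕ j × toℕ j1 ≡ suc (toℕ j) × toℕ j1 < toℕ k ×
  (π ! j1) < (π ! i) × (π ! i) < (π ! k) × (π ! k) < (π ! j)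

OccM : (π : List ℕ) → Fin (length π) → Set
OccM π i = Σ (Fin (length π)) λ j → toℕ j ≡ suc (toℕ i) × (π ! i) > (π ! j) ×
  ((k : Fin (length π)) → toℕ j < toℕ k → ((π ! k) > (π ! i) ⊎ (π ! k) < (π ! j)))

occM? : (π : List ℕ) → (i : Fin (length π)) → Dec (OccM π i)
occM? π i = any? λ j → (toℕ j ≟ suc (toℕ i)) ×-dec ((π ! j) <? (π ! i)) ×-dec
  all? (λ k → (toℕ j <? toℕ k) →-dec (((π ! i) <? (π ! k)) ⊎-dec ((π ! k) <? (π ! j))))

countM : List ℕ → ℕ
countM π = length (filter (occM? π) (allFin (length π)))

LRMax : (π : List ℕ) → Fin (length π) → Set
LRMax π i = (j : Fin (length π)) → toℕ j < toℕ i → (π ! j) < (π ! i)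

insertBefore : (π : List ℕ) → Fin (length π) → ℕ → List ℕ
insertBefore π p a = take (toℕ p) π ++ (a ∷ drop (toℕ p) π)

module Submission where

-- Inserting a letter N that exceeds every letter of a list xs immediately
-- before a left-to-right maximum at position p changes the occurrences of
-- the mesh pattern M only at the new descent N, x_p: an occurrence at an
-- index i with i + 1 < p or i ≥ p survives (shifted past the new letter),
-- no occurrence sits at i = p - 1 either before or after the insertion (x_p
-- is a left-to-right maximum, and N is larger still), and the new descent
-- N, x_p is an occurrence exactly when no later letter exceeds x_p.
-- For a permutation the letters are distinct, so every letter after the
-- last left-to-right maximum is smaller than it (the first larger one would
-- be a later left-to-right maximum), while a later left-to-right maximum is
-- a larger letter after p. This gives m + 1 resp. m occurrences.

open import Defs
open import Data.Nat using (ℕ; zero; suc; _<_; _≤_; _+_; z≤n; s≤s; _<?_; s≤s⁻¹)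
open import Data.Nat.Properties
open import Data.Nat.Induction using (<-rec)
open import Data.Fin using (Fin; toℕ; fromℕ<) renaming (zero to fzero; suc to fsuc)
open import Data.Fin.Properties using (toℕ-fromℕ<; toℕ<n)
open import Data.List using (List; []; _∷_; length; lookup; take; drop; _++_; filter; tabulate)
open import Data.List.Membership.Propositional using (_∈_)
open import Data.List.Membership.Propositional.Properties using (∈-applyUpTo⁻)
open import Data.List.Relation.Unary.Any using (here; there)
open import Data.List.Relation.Unary.All using (All; _∷_)
open import Data.List.Relation.Unary.AllPairs using (_∷_)
open import Data.List.Relation.Unary.Unique.Propositional using (Unique)
open import Data.List.Relation.Unary.Unique.Propositional.Properties using (applyUpTo⁺₁)
open import Data.List.Relation.Binary.Permutation.Propositional using (↭-sym; ↭⇒↭ₛ)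
open import Data.List.Relation.Binary.Permutation.Propositional.Properties using (∈-resp-↭)
import Data.List.Relation.Binary.Permutation.Setoid.Properties as PermutationSetoid
open import Algebra.Properties.CommutativeSemigroup +-commutativeSemigroup using (x∙yz≈y∙xz)
open import Data.Bool using (Bool; true; false)
open import Data.Product using (Σ; _×_; _,_; proj₁)
open import Data.Sum using (_⊎_; inj₁; inj₂)
open import Data.Empty using (⊥-elim)
open import Relation.Nullary using (¬_; yes; no; does)
open import Relation.Unary using (Decidable)
open import Relation.Binary.Definitions using (tri<; tri≈; tri>)
open import Relation.Binary.PropositionalEquality

-- Positional access with natural-number indices (0 outside the list);
-- it lets indices be shifted and compared by plain arithmetic.
at : List ℕ → ℕ → ℕ
at [] _ = 0
at (x ∷ xs) zero = x
at (x ∷ xs) (suc i) = at xs i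

lookup≡at : ∀ xs (i : Fin (length xs)) → lookup xs i ≡ at xs (toℕ i)
lookup≡at (x ∷ xs) fzero = refl
lookup≡at (x ∷ xs) (fsuc i) = lookup≡at xs i

lookup-fromℕ<≡at : ∀ xs {i} (i<len : i < length xs) → lookup xs (fromℕ< i<len) ≡ at xs i
lookup-fromℕ<≡at xs i<len = trans (lookup≡at xs (fromℕ< i<len)) (cong (at xs) (toℕ-fromℕ< i<len))

at∈ : ∀ xs i → i < length xs → at xs i ∈ xs
at∈ (x ∷ xs) zero _ = here refl
at∈ (x ∷ xs) (suc i) (s≤s i<len) = there (at∈ xs i i<len)

at-All : ∀ {P : ℕ → Set} xs → All P xs → ∀ i → i < length xs → P (at xs i)
at-All (x ∷ xs) (px ∷ _) zero _ = px
at-All (x ∷ xs) (_ ∷ pxs) (suc i) (s≤s i<len) = at-All xs pxs i i<len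

at-distinct : ∀ xs → Unique xs → ∀ i j → i < j → j < length xs → at xs i ≢ at xs j
at-distinct (x ∷ xs) (x∉xs ∷ _) zero (suc j) _ (s≤s j<len) = at-All xs x∉xs j j<len
at-distinct (x ∷ xs) (_ ∷ u) (suc i) (suc j) (s≤s i<j) (s≤s j<len) = at-distinct xs u i j i<j j<len

LRMaxAt : List ℕ → ℕ → Set
LRMaxAt xs p = ∀ j → j < p → at xs j < at xs p

LRMax⇒LRMaxAt : ∀ xs (p : Fin (length xs)) → LRMax xs p → LRMaxAt xs (toℕ p)
LRMax⇒LRMaxAt xs p lrp j j<p =
  subst₂ _<_ (lookup-fromℕ<≡at xs j<len) (lookup≡at xs p)
    (lrp (fromℕ< j<len) (subst (_< toℕ p) (sym (toℕ-fromℕ< j<len)) j<p))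
  where j<len = <-trans j<p (toℕ<n p)

LRMaxAt⇒LRMax : ∀ xs {p} (p<len : p < length xs) → LRMaxAt xs p → LRMax xs (fromℕ< p<len)
LRMaxAt⇒LRMax xs p<len lrp j j<p =
  subst₂ _<_ (sym (lookup≡at xs j)) (sym (lookup-fromℕ<≡at xs p<len))
    (lrp (toℕ j) (subst (toℕ j <_) (toℕ-fromℕ< p<len) j<p))

-- In a list with distinct letters every letter after the last
-- left-to-right maximum is smaller than it: by strong induction, the first
-- later letter exceeding it would be a later left-to-right maximum.
afterLastLRMax : ∀ xs → Unique xs → (p : Fin (length xs)) → LRMax xs p →
  ((q : Fin (length xs)) → LRMax xs q → toℕ q ≤ toℕ p) →
  ∀ j → toℕ p < j → j < length xs → at xs j < at xs (toℕ p)
afterLastLRMax xs unique p lrp isLast = <-rec P step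
  where
    P : ℕ → Set
    P j = toℕ p < j → j < length xs → at xs j < at xs (toℕ p)

    step : ∀ j → (∀ {i} → i < j → P i) → P j
    step j ih p<j j<len with <-cmp (at xs j) (at xs (toℕ p))
    ... | tri< smaller _ _ = smaller
    ... | tri≈ _ same _ = ⊥-elim (at-distinct xs unique (toℕ p) j p<j j<len (sym same))
    ... | tri> _ _ larger =
      ⊥-elim (<⇒≱ p<j (subst (_≤ toℕ p) (toℕ-fromℕ< j<len)
        (isLast (fromℕ< j<len) (LRMaxAt⇒LRMax xs j<len jIsLRMax))))
      where
        jIsLRMax : LRMaxAt xs j
        jIsLRMax i i<j with <-cmp i (toℕ p)
        ... | tri< i<p _ _ = <-trans (LRMax⇒LRMaxAt xs p lrp i i<p) larger
        ... | tri≈ _ refl _ = larger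
        ... | tri> _ _ p<i = <-trans (ih i<j p<i (<-trans i<j j<len)) larger

perm-letters-< : ∀ k π → IsPerm k π → ∀ i → i < length π → at π i < suc k
perm-letters-< k π perm i i<len with ∈-applyUpTo⁻ suc (∈-resp-↭ perm (at∈ π i i<len))
... | j , j<k , letter≡ = subst (_< suc k) (sym letter≡) (s≤s j<k)

perm-unique : ∀ k π → IsPerm k π → Unique π
perm-unique k π perm = PermutationSetoid.Unique-resp-↭ (setoid ℕ) (↭⇒↭ₛ (↭-sym perm))
  (applyUpTo⁺₁ suc k (λ i<j _ eq → <⇒≢ i<j (suc-injective eq)))

-- Insertion of the letter N before position p, with natural-number p;
-- insertBefore π p N is definitionally ins π (toℕ p) N.
ins : List ℕ → ℕ → ℕ → List ℕ
ins xs p N = take p xs ++ (N ∷ drop p xs)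

length-ins : ∀ xs p N → p ≤ length xs → length (ins xs p N) ≡ suc (length xs)
length-ins xs zero N _ = refl
length-ins (x ∷ xs) (suc p) N (s≤s p≤len) = cong suc (length-ins xs p N p≤len)

at-ins-before : ∀ xs p N i → i < p → p ≤ length xs → at (ins xs p N) i ≡ at xs i
at-ins-before (x ∷ xs) (suc p) N zero _ _ = refl
at-ins-before (x ∷ xs) (suc p) N (suc i) (s≤s i<p) (s≤s p≤len) = at-ins-before xs p N i i<p p≤len

at-ins-at : ∀ xs p N → p ≤ length xs → at (ins xs p N) p ≡ N
at-ins-at xs zero N _ = refl
at-ins-at (x ∷ xs) (suc p) N (s≤s p≤len) = at-ins-at xs p N p≤len

at-ins-after : ∀ xs p N i → p ≤ i → at (ins xs p N) (suc i) ≡ at xs i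
at-ins-after xs zero N i _ = refl
at-ins-after [] (suc p) N i _ = refl
at-ins-after (x ∷ xs) (suc p) N (suc i) (s≤s p≤i) = at-ins-after xs p N i p≤i

Outside : ℕ → ℕ → ℕ → Set
Outside lo hi x = hi < x ⊎ x < lo

subst-Outside : ∀ {lo lo′ hi hi′ x x′} → lo ≡ lo′ → hi ≡ hi′ → x ≡ x′ →
  Outside lo hi x → Outside lo′ hi′ x′
subst-Outside refl refl refl outside = outside

OccAt : List ℕ → ℕ → Set
OccAt xs i = (suc i < length xs) × (at xs (suc i) < at xs i) ×
  (∀ k → suc i < k → k < length xs → Outside (at xs (suc i)) (at xs i) (at xs k))

OccM⇒OccAt : ∀ xs i → OccM xs i → OccAt xs (toℕ i)
OccM⇒OccAt xs i (j , j≡ , descent , mesh) =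
  subst (_< length xs) j≡ (toℕ<n j) ,
  subst₂ _<_ atj (lookup≡at xs i) descent ,
  λ k i+1<k k<len → subst-Outside atj (lookup≡at xs i) (lookup-fromℕ<≡at xs k<len)
    (mesh (fromℕ< k<len) (subst₂ _<_ (sym j≡) (sym (toℕ-fromℕ< k<len)) i+1<k))
  where atj = trans (lookup≡at xs j) (cong (at xs) j≡)

OccAt⇒OccM : ∀ xs i → OccAt xs (toℕ i) → OccM xs i
OccAt⇒OccM xs i (i+1<len , descent , mesh) =
  fromℕ< i+1<len , toℕ-fromℕ< i+1<len ,
  subst₂ _<_ (sym (lookup-fromℕ<≡at xs i+1<len)) (sym (lookup≡at xs i)) descent ,
  λ k j<k → subst-Outside (sym (lookup-fromℕ<≡at xs i+1<len)) (sym (lookup≡at xs i))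
    (sym (lookup≡at xs k))
    (mesh (toℕ k) (subst (_< toℕ k) (toℕ-fromℕ< i+1<len) j<k) (toℕ<n k))

occ : List ℕ → ℕ → Bool
occ xs i with i <? length xs
... | yes i<len = does (occM? xs (fromℕ< i<len))
... | no _ = false

occ-inRange : ∀ xs i (i<len : i < length xs) → occ xs i ≡ does (occM? xs (fromℕ< i<len))
occ-inRange xs i i<len with i <? length xs
... | yes _ = refl
... | no i≮len = ⊥-elim (i≮len i<len)

occ-sound : ∀ xs i → occ xs i ≡ true → OccAt xs i
occ-sound xs i occ≡true with i <? length xs
... | yes i<len with occM? xs (fromℕ< i<len)
...   | yes o = subst (OccAt xs) (toℕ-fromℕ< i<len) (OccM⇒OccAt xs _ o)

occ-complete : ∀ xs i → OccAt xs i → occ xs i ≡ true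
occ-complete xs i o with i <? length xs
... | no i≮len = ⊥-elim (i≮len (<-trans (n<1+n i) (proj₁ o)))
... | yes i<len with occM? xs (fromℕ< i<len)
...   | yes _ = refl
...   | no ¬o = ⊥-elim (¬o (OccAt⇒OccM xs _ (subst (OccAt xs) (sym (toℕ-fromℕ< i<len)) o)))

occ-false : ∀ xs i → ¬ OccAt xs i → occ xs i ≡ false
occ-false xs i ¬o with occ xs i in eq
... | false = refl
... | true = ⊥-elim (¬o (occ-sound xs i eq))

occ-cong : ∀ xs ys i j → (OccAt xs i → OccAt ys j) → (OccAt ys j → OccAt xs i) →
  occ xs i ≡ occ ys j
occ-cong xs ys i j to from with occ xs i in eq₁ | occ ys j in eq₂
... | true | true = refl
... | false | false = refl
... | true | false = trans (sym (occ-complete ys j (to (occ-sound xs i eq₁)))) eq₂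
... | false | true = trans (sym eq₁) (occ-complete xs i (from (occ-sound ys j eq₂)))

b2n : Bool → ℕ
b2n true = 1
b2n false = 0

countTrue : ℕ → (ℕ → Bool) → ℕ
countTrue zero g = 0
countTrue (suc n) g = b2n (g 0) + countTrue n (λ i → g (suc i))

countTrue-cong : ∀ n g h → (∀ i → i < n → g i ≡ h i) → countTrue n g ≡ countTrue n h
countTrue-cong zero g h _ = refl
countTrue-cong (suc n) g h g≡h = cong₂ _+_ (cong b2n (g≡h 0 (s≤s z≤n)))
  (countTrue-cong n (λ i → g (suc i)) (λ i → h (suc i)) (λ i i<n → g≡h (suc i) (s≤s i<n)))

length-filter-∷ : ∀ {A : Set} {P : A → Set} (P? : Decidable P) x xs →
  length (filter P? (x ∷ xs)) ≡ b2n (does (P? x)) + length (filter P? xs)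
length-filter-∷ P? x xs with does (P? x)
... | true = refl
... | false = refl

length-filter-tabulate : ∀ {L} {P : Fin L → Set} (P? : Decidable P) n (f : Fin n → Fin L)
  (g : ℕ → Bool) → (∀ i (i<n : i < n) → g i ≡ does (P? (f (fromℕ< i<n)))) →
  length (filter P? (tabulate f)) ≡ countTrue n g
length-filter-tabulate P? zero f g _ = refl
length-filter-tabulate P? (suc n) f g g≡ =
  trans (length-filter-∷ P? (f fzero) (tabulate (λ i → f (fsuc i))))
    (cong₂ _+_ (cong b2n (sym (g≡ 0 (s≤s z≤n))))
      (length-filter-tabulate P? n (λ i → f (fsuc i)) (λ i → g (suc i))
        (λ i i<n → g≡ (suc i) (s≤s i<n))))

countM≡countTrue : ∀ xs → countM xs ≡ countTrue (length xs) (occ xs)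
countM≡countTrue xs =
  length-filter-tabulate (occM? xs) (length xs) (λ i → i) (occ xs) (occ-inRange xs)

skip : ℕ → ℕ → ℕ
skip zero i = suc i
skip (suc p) zero = zero
skip (suc p) (suc i) = suc (skip p i)

skip-below : ∀ p i → i < p → skip p i ≡ i
skip-below (suc p) zero _ = refl
skip-below (suc p) (suc i) (s≤s i<p) = cong suc (skip-below p i i<p)

skip-above : ∀ p i → p ≤ i → skip p i ≡ suc i
skip-above zero i _ = refl
skip-above (suc p) (suc i) (s≤s p≤i) = cong suc (skip-above p i p≤i)

countTrue-split : ∀ p L g → p ≤ L →
  countTrue (suc L) g ≡ b2n (g p) + countTrue L (λ i → g (skip p i))
countTrue-split zero L g _ = refl
countTrue-split (suc p) (suc L) g (s≤s p≤L) =
  trans (cong (b2n (g 0) +_) (countTrue-split p L (λ i → g (suc i)) p≤L))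
        (x∙yz≈y∙xz (b2n (g 0)) (b2n (g (suc p))) _)

module InsertBeforeLRMax (xs : List ℕ) (N p : ℕ) (p<len : p < length xs)
  (below-N : ∀ i → i < length xs → at xs i < N)
  (lrp : LRMaxAt xs p) where

  L : ℕ
  L = length xs

  σ : List ℕ
  σ = ins xs p N

  length-σ : length σ ≡ suc L
  length-σ = length-ins xs p N (<⇒≤ p<len)

  σ-before : ∀ i → i < p → at σ i ≡ at xs i
  σ-before i i<p = at-ins-before xs p N i i<p (<⇒≤ p<len)

  σ-at : at σ p ≡ N
  σ-at = at-ins-at xs p N (<⇒≤ p<len)

  σ-after : ∀ i → p ≤ i → at σ (suc i) ≡ at xs i
  σ-after i p≤i = at-ins-after xs p N i p≤i

  inσ : ∀ {k} → k < suc L → k < length σ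
  inσ {k} = subst (k <_) (sym length-σ)

  fromσ : ∀ {k} → k < length σ → k < suc L
  fromσ {k} = subst (k <_) length-σ

  -- Occurrences entirely before the new letter are unchanged; a letter
  -- N after them is outside every interval.
  occ-before→ : ∀ i → suc i < p → OccAt σ i → OccAt xs i
  occ-before→ i i+1<p (_ , descent , mesh) =
    <-trans i+1<p p<len ,
    subst₂ _<_ (σ-before (suc i) i+1<p) (σ-before i i<p) descent ,
    mesh′
    where
      i<p = <-trans (n<1+n i) i+1<p
      mesh′ : ∀ k → suc i < k → k < L → Outside (at xs (suc i)) (at xs i) (at xs k)
      mesh′ k i+1<k k<L with k <? p
      ... | yes k<p = subst-Outside (σ-before (suc i) i+1<p) (σ-before i i<p) (σ-before k k<p)
                        (mesh k i+1<k (inσ (m<n⇒m<1+n k<L)))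
      ... | no k≮p = subst-Outside (σ-before (suc i) i+1<p) (σ-before i i<p) (σ-after k (≮⇒≥ k≮p))
                        (mesh (suc k) (m<n⇒m<1+n i+1<k) (inσ (s≤s k<L)))

  occ-before← : ∀ i → suc i < p → OccAt xs i → OccAt σ i
  occ-before← i i+1<p (i+1<L , descent , mesh) =
    inσ (m<n⇒m<1+n i+1<L) ,
    subst₂ _<_ (sym (σ-before (suc i) i+1<p)) (sym (σ-before i i<p)) descent ,
    mesh′
    where
      i<p = <-trans (n<1+n i) i+1<p
      back : ∀ {k x} → at xs k ≡ x → Outside (at xs (suc i)) (at xs i) (at xs k) →
        Outside (at σ (suc i)) (at σ i) x
      back = subst-Outside (sym (σ-before (suc i) i+1<p)) (sym (σ-before i i<p))
      mesh′ : ∀ k → suc i < k → k < length σ → Outside (at σ (suc i)) (at σ i) (at σ k)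
      mesh′ k i+1<k k<σ with <-cmp k p
      ... | tri< k<p _ _ = back (sym (σ-before k k<p)) (mesh k i+1<k (<-trans k<p p<len))
      ... | tri≈ _ refl _ =
        inj₁ (subst₂ _<_ (sym (σ-before i i<p)) (sym σ-at) (below-N i (<-trans i<p p<len)))
      mesh′ (suc k) i+1<k k<σ | tri> _ _ p<k+1 =
        back (sym (σ-after k (s≤s⁻¹ p<k+1)))
          (mesh k (<-≤-trans i+1<p (s≤s⁻¹ p<k+1)) (s≤s⁻¹ (fromσ k<σ)))

  -- Just before position p there is no descent, neither before the insertion
  -- (x_p is a left-to-right maximum) nor after it (N is larger still).
  no-occ-σ-before-p : ∀ i → suc i ≡ p → ¬ OccAt σ i
  no-occ-σ-before-p i refl (_ , descent , _) =
    <-asym descent (subst₂ _<_ (sym (σ-before i (n<1+n i))) (sym σ-at)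
      (below-N i (<-trans (n<1+n i) p<len)))

  no-occ-xs-before-p : ∀ i → suc i ≡ p → ¬ OccAt xs i
  no-occ-xs-before-p i refl (_ , descent , _) = <-asym descent (lrp i (n<1+n i))

  occ-after→ : ∀ i → p ≤ i → OccAt σ (suc i) → OccAt xs i
  occ-after→ i p≤i (i+2<σ , descent , mesh) =
    s≤s⁻¹ (fromσ i+2<σ) ,
    subst₂ _<_ (σ-after (suc i) p≤i+1) (σ-after i p≤i) descent ,
    λ k i+1<k k<L → subst-Outside (σ-after (suc i) p≤i+1) (σ-after i p≤i)
      (σ-after k (≤-trans p≤i (<⇒≤ (<-trans (n<1+n i) i+1<k))))
      (mesh (suc k) (s≤s i+1<k) (inσ (s≤s k<L)))
    where p≤i+1 = m≤n⇒m≤1+n p≤i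

  occ-after← : ∀ i → p ≤ i → OccAt xs i → OccAt σ (suc i)
  occ-after← i p≤i (i+1<L , descent , mesh) =
    inσ (s≤s i+1<L) ,
    subst₂ _<_ (sym (σ-after (suc i) p≤i+1)) (sym (σ-after i p≤i)) descent ,
    mesh′
    where
      p≤i+1 = m≤n⇒m≤1+n p≤i
      mesh′ : ∀ k → suc (suc i) < k → k < length σ →
        Outside (at σ (suc (suc i))) (at σ (suc i)) (at σ k)
      mesh′ (suc k) i+2<k+1 k+1<σ =
        subst-Outside (sym (σ-after (suc i) p≤i+1)) (sym (σ-after i p≤i))
          (sym (σ-after k (≤-trans p≤i (<⇒≤ (<-trans (n<1+n i) (s≤s⁻¹ i+2<k+1))))))
          (mesh k (s≤s⁻¹ i+2<k+1) (s≤s⁻¹ (fromσ k+1<σ)))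

  occ-at-p : (∀ k → p < k → k < L → at xs k < at xs p) → OccAt σ p
  occ-at-p later-smaller =
    inσ (s≤s p<len) ,
    subst₂ _<_ (sym (σ-after p ≤-refl)) (sym σ-at) (below-N p p<len) ,
    mesh
    where
      mesh : ∀ k → suc p < k → k < length σ → Outside (at σ (suc p)) (at σ p) (at σ k)
      mesh (suc k) p+1<k+1 k+1<σ =
        inj₂ (subst₂ _<_ (sym (σ-after k (<⇒≤ (s≤s⁻¹ p+1<k+1)))) (sym (σ-after p ≤-refl))
          (later-smaller k (s≤s⁻¹ p+1<k+1) (s≤s⁻¹ (fromσ k+1<σ))))

  no-occ-at-p : ∀ q → p < q → q < L → at xs p < at xs q → ¬ OccAt σ p
  no-occ-at-p q p<q q<L larger (_ , _ , mesh) with mesh (suc q) (s≤s p<q) (inσ (s≤s q<L))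
  ... | inj₁ above-N = <-asym (below-N q q<L) (subst₂ _<_ σ-at (σ-after q (<⇒≤ p<q)) above-N)
  ... | inj₂ below-xp =
    <-asym larger (subst₂ _<_ (σ-after q (<⇒≤ p<q)) (σ-after p ≤-refl) below-xp)

  countM-σ : countM σ ≡ b2n (occ σ p) + countM xs
  countM-σ = begin
    countM σ
      ≡⟨ countM≡countTrue σ ⟩
    countTrue (length σ) (occ σ)
      ≡⟨ cong (λ n → countTrue n (occ σ)) length-σ ⟩
    countTrue (suc L) (occ σ)
      ≡⟨ countTrue-split p L (occ σ) (<⇒≤ p<len) ⟩
    b2n (occ σ p) + countTrue L (λ i → occ σ (skip p i))
      ≡⟨ cong (b2n (occ σ p) +_) (countTrue-cong L _ (occ xs) unchanged) ⟩
    b2n (occ σ p) + countTrue L (occ xs)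
      ≡⟨ cong (b2n (occ σ p) +_) (sym (countM≡countTrue xs)) ⟩
    b2n (occ σ p) + countM xs
      ∎
    where
      open ≡-Reasoning
      unchanged : ∀ i → i < L → occ σ (skip p i) ≡ occ xs i
      unchanged i _ with <-cmp (suc i) p
      ... | tri< i+1<p _ _ rewrite skip-below p i (<-trans (n<1+n i) i+1<p) =
        occ-cong σ xs i i (occ-before→ i i+1<p) (occ-before← i i+1<p)
      ... | tri≈ _ refl _ rewrite skip-below (suc i) i (n<1+n i) =
        trans (occ-false σ i (no-occ-σ-before-p i refl))
              (sym (occ-false xs i (no-occ-xs-before-p i refl)))
      ... | tri> _ _ p<i+1 rewrite skip-above p i (s≤s⁻¹ p<i+1) =
        occ-cong σ xs (suc i) i (occ-after→ i (s≤s⁻¹ p<i+1)) (occ-after← i (s≤s⁻¹ p<i+1))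

lemma6 : (k m : ℕ) (π : List ℕ) → IsPerm k π →
    ¬ Contains3142 π → ¬ Contains2413v π → countM π ≡ m →
    (p : Fin (length π)) → LRMax π p →
    (((q : Fin (length π)) → LRMax π q → toℕ q ≤ toℕ p) →
      countM (insertBefore π p (suc k)) ≡ suc m)
    × ((Σ (Fin (length π)) λ q → LRMax π q × toℕ p < toℕ q) →
      countM (insertBefore π p (suc k)) ≡ m)
lemma6 k m π perm _ _ count≡m p lrp = whenLast , whenNotLast
  where
    open InsertBeforeLRMax π (suc k) (toℕ p) (toℕ<n p) (perm-letters-< k π perm)
      (LRMax⇒LRMaxAt π p lrp)

    -- After the last left-to-right maximum all letters are smaller: a new occurrence.
    whenLast : ((q : Fin (length π)) → LRMax π q → toℕ q ≤ toℕ p) → countM σ ≡ suc m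
    whenLast isLast = trans countM-σ (cong₂ (λ b c → b2n b + c)
      (occ-complete σ (toℕ p) (occ-at-p (afterLastLRMax π (perm-unique k π perm) p lrp isLast)))
      count≡m)

    -- A later left-to-right maximum is a larger later letter: no new occurrence.
    whenNotLast : (Σ (Fin (length π)) λ q → LRMax π q × toℕ p < toℕ q) → countM σ ≡ m
    whenNotLast (q , lrq , p<q) = trans countM-σ (cong₂ (λ b c → b2n b + c)
      (occ-false σ (toℕ p) (no-occ-at-p (toℕ q) p<q (toℕ<n q) (LRMax⇒LRMaxAt π q lrq (toℕ p) p<q)))
      count≡m)
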